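{- For every $\varepsilon>0$ and every integer $n\ge 2$ there exist a positive integer $m$ and a reducible set $X\subseteq\{0,1,\dots,m-1\}^n$ such that $AvgDeg_i(X)\ge n-\varepsilon$ for all $i\in\{1,\dots,n\}$.
   Context: For $X\subseteq A^n$ ($A$ finite) and $i\in[n]$, $X_{[n]\setminus\{i\}}$ is the projection of $X$ onto all coordinates except the $i$-th. $G_i(X)$ is the bipartite graph with left vertices $A$, right vertices $X_{[n]\setminus\{i\}}$, and $a$ adjacent to $(x_1,\dots,x_{i-1},x_{i+1},\dots,x_n)$ iff $(x_1,\dots,x_{i-1},a,x_{i+1},\dots,x_n)\in X$. $MinDeg_i(X)$ is the minimum degree of a right vertex of $G_i(X)$; $AvgDeg_i(X)=|X|/|X_{[n]\setminus\{i\}}|$. A set $X\subseteq\{0,\dots,m-1\}^n$ is reducible if every non-empty $Y\subseteq X$ has some $i\in[n]$ with $MinDeg_i(Y)=1$. -}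

module Defs where

open import Data.Nat using (ℕ; zero; suc; pred; _⊓_)
open import Data.Fin using (Fin)
open import Data.Fin.Properties using () renaming (_≟_ to _≟F_)
open import Data.Vec using (Vec; removeAt; insertAt)
open import Data.Vec.Properties using (≡-dec)
open import Data.List using (List; []; _∷_; length; map; filter; deduplicate; allFin)
open import Data.List.Membership.DecPropositional using ()
import Data.List.Membership.DecPropositional as DecMem
open import Data.List.Relation.Binary.Subset.Propositional using (_⊆_)
open import Data.Product using (∃)
open import Relation.Binary.PropositionalEquality using (_≡_)
open import Relation.Nullary using (¬_)

Point : ℕ → ℕ → Set
Point m n = Vec (Fin m) n

-- A finite subset of {0,…,m-1}^n, represented as a list of points
-- (duplicate-free where cardinality matters).
-- x ↦ x_{[n]∖{i}} : delete the i-th coordinate.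
del : ∀ {m n} → Point m n → Fin n → Point m (pred n)
del {n = suc n} x i = removeAt x i

ins : ∀ {m n} → Point m (pred n) → Fin n → Fin m → Point m n
ins {n = suc n} w i a = insertAt w i a

_≟P_ : ∀ {m n} (x y : Point m n) → Relation.Nullary.Dec (x ≡ y)
_≟P_ = ≡-dec _≟F_

-- X_{[n]∖{i}} as a duplicate-free list (right vertices of G_i(X)).
Proj : ∀ {m n} → Fin n → List (Point m n) → List (Point m (pred n))
Proj i X = deduplicate _≟P_ (map (λ x → del x i) X)

degree : ∀ {m n} → Fin n → List (Point m n) → Point m (pred n) → ℕ
degree {m} i X w = length (filter (λ a → DecMem._∈?_ _≟P_ (ins w i a) X) (allFin m))

-- minimum of a list of naturals (0 for the empty list; only used on non-empty lists)
minList : List ℕ → ℕ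
minList [] = 0
minList (x ∷ []) = x
minList (x ∷ y ∷ ys) = x ⊓ minList (y ∷ ys)

MinDeg : ∀ {m n} → Fin n → List (Point m n) → ℕ
MinDeg i X = minList (map (degree i X) (Proj i X))

Reducible : ∀ {m n} → List (Point m n) → Set
Reducible {m} {n} X = (Y : List (Point m n)) → Y ⊆ X → ¬ (Y ≡ []) → ∃ λ (i : Fin n) → MinDeg i Y ≡ 1

module Submission where

open import Defs
open import Data.Empty using (⊥-elim)
open import Data.Fin using (Fin; zero; suc; toℕ)
open import Data.Fin.Properties using (toℕ-injective; toℕ<n; toℕ-fromℕ<) renaming (_≟_ to _≟ᶠ_)
open import Data.List using (List; []; _∷_; [_]; length; map; concatMap; filter; downFrom)
open import Data.List.Extrema.Nat using (argmax; argmax-all; f[xs]≤f[argmax])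
open import Data.List.Fresh as Fresh using ()
open import Data.List.Fresh.Membership.Setoid.Properties using (injection)
open import Data.List.Fresh.Relation.Unary.Any using (here; there) renaming (Any to Any#)
import Data.List.Membership.DecPropositional as DecMembership
open import Data.List.Membership.Propositional using (_∈_; find; lose)
open import Data.List.Membership.Propositional.Properties
  using (∈-filter⁺; ∈-filter⁻; ∈-map⁺; ∈-map⁻; ∈-deduplicate⁺; ∈-deduplicate⁻; ∈-allFin; ∈-concatMap⁺; ∈-concatMap⁻; ∈-downFrom⁺; ∈-downFrom⁻)
open import Data.List.Properties using (length-map; length-++; length-downFrom; map-cong)
open import Data.List.Relation.Binary.Disjoint.Propositional using (Disjoint)
open import Data.List.Relation.Binary.Subset.Propositional using (_⊆_)
import Data.List.Relation.Unary.All as All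
import Data.List.Relation.Unary.All.Properties as All
open import Data.List.Relation.Unary.AllPairs using (AllPairs; []; _∷_)
import Data.List.Relation.Unary.AllPairs as AllPairs
import Data.List.Relation.Unary.AllPairs.Properties as AllPairs
open import Data.List.Relation.Unary.Any using (Any; here; there; any?)
open import Data.List.Relation.Unary.Unique.DecPropositional.Properties using (deduplicate-!)
open import Data.List.Relation.Unary.Unique.Propositional using (Unique)
import Data.List.Relation.Unary.Unique.Propositional.Properties as Unique
open import Data.Nat using (ℕ; zero; suc; _+_; _*_; _∸_; _^_; _≤_; _<_; _⊓_; _≤?_; z≤n; s≤s; s≤s⁻¹; NonZero; >-nonZero; _≤′_; ≤′-refl; ≤′-step)
open import Data.Nat.DivMod using (_mod_; m%n≤m; m<n⇒m%n≡m)
open import Data.Nat.ListAction using (sum)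
open import Data.Nat.Properties
open import Algebra.Properties.CommutativeSemigroup +-commutativeSemigroup using (x∙yz≈y∙xz; xy∙z≈xz∙y)
open import Data.Nat.Tactic.RingSolver using (solve-∀)
open import Data.Product using (Σ; ∃; ∃₂; _×_; _,_; proj₁; proj₂)
open import Data.Vec using (Vec; []; _∷_; head; tail; lookup; insertAt; removeAt)
import Data.Vec as Vec
open import Data.Vec.Properties using (∷-injective; ∷-injectiveʳ; map-insertAt; insertAt-removeAt; removeAt-insertAt; insertAt-lookup)
open import Function using (id; _∘_; _on_; case_of_)
open import Relation.Binary.PropositionalEquality
  using (_≡_; _≢_; refl; sym; trans; cong; cong₂; subst; subst₂; setoid; module ≡-Reasoning)
open import Relation.Nullary using (¬_; Dec; yes; no)
open import Relation.Unary using (Decidable)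

-- Take X to be the points of {0,…,m−1}ⁿ whose coordinate sum lies in [k, k+n−1].
-- In a non-empty Y ⊆ X let a be the largest first coordinate. If some point of Y
-- with first coordinate a has the least possible sum k, it is alone on its line in
-- the first direction; otherwise the points with first coordinate a, with that
-- coordinate deleted, form a band of width n−1 in dimension n−1, and induction gives
-- a point alone on its line in another direction. For the degrees: every point of
-- the (n−1)-dimensional simplex of radius k extends to n points of X, while every
-- projection of X lies in the simplex of radius k+n−1. Simplex sizes grow
-- polynomially in the radius, so for large k their ratio is close to 1.

module _ {A : Set} where

  -- A unique list is a fresh list for _≢_, for which the library has the
  -- pigeonhole bound `injection`.
  private
    length-fromList : ∀ {xs : List A} (xs! : Unique xs) → Fresh.length (Fresh.fromList xs!) ≡ length xs
    length-fromList [] = refl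
    length-fromList (_ ∷ xs!) = cong suc (length-fromList xs!)

    ∈-fromList⁺ : ∀ {x} {xs : List A} (xs! : Unique xs) → x ∈ xs → Any# (x ≡_) (Fresh.fromList xs!)
    ∈-fromList⁺ (_ ∷ xs!) (here eq) = here eq
    ∈-fromList⁺ (_ ∷ xs!) (there p) = there (∈-fromList⁺ xs! p)

    ∈-fromList⁻ : ∀ {x} {xs : List A} (xs! : Unique xs) → Any# (x ≡_) (Fresh.fromList xs!) → x ∈ xs
    ∈-fromList⁻ (_ ∷ xs!) (here eq) = here eq
    ∈-fromList⁻ (_ ∷ xs!) (there p) = there (∈-fromList⁻ xs! p)

  length-mono-⊆ : ∀ {xs ys : List A} → Unique xs → Unique ys → xs ⊆ ys → length xs ≤ length ys
  length-mono-⊆ xs! ys! xs⊆ys = subst₂ _≤_ (length-fromList xs!) (length-fromList ys!)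
    (injection (setoid A) id (∈-fromList⁺ ys! ∘ xs⊆ys ∘ ∈-fromList⁻ xs!))

  1≤length : ∀ {x} {xs : List A} → x ∈ xs → 1 ≤ length xs
  1≤length (here _) = s≤s z≤n
  1≤length (there _) = s≤s z≤n

  length-filter≡1 : ∀ {P : A → Set} (P? : Decidable P) {xs b} → Unique xs → b ∈ xs → P b →
    (∀ {a} → P a → a ≡ b) → length (filter P? xs) ≡ 1
  length-filter≡1 P? {xs} xs! b∈xs Pb P⇒≡b = ≤-antisym
    (length-mono-⊆ (Unique.filter⁺ P? xs!) (All.[] ∷ []) (λ a∈ → here (P⇒≡b (proj₂ (∈-filter⁻ P? {xs = xs} a∈)))))
    (1≤length (∈-filter⁺ P? b∈xs Pb))

module _ {A B : Set} where

  unique-map⁺ : ∀ {f : A → B} {xs} → (∀ {x y} → x ∈ xs → y ∈ xs → f x ≡ f y → x ≡ y) →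
    Unique xs → Unique (map f xs)
  unique-map⁺ {xs = []} _ [] = []
  unique-map⁺ {xs = x ∷ xs} inj (x∉xs ∷ xs!) =
    All.map⁺ (All.tabulate λ y∈xs fx≡fy → All.lookup x∉xs y∈xs (inj (here refl) (there y∈xs) fx≡fy))
    ∷ unique-map⁺ (λ x∈ y∈ → inj (there x∈) (there y∈)) xs!

  unique-concatMap⁺ : ∀ {C : Set} (label : B → C) {tag : A → C} {f : A → List B} {xs} →
    AllPairs (_≢_ on tag) xs → (∀ {x} → x ∈ xs → Unique (f x)) →
    (∀ x {z} → z ∈ f x → label z ≡ tag x) → Unique (concatMap f xs)
  unique-concatMap⁺ label {tag} {f} tags f! labelled =
    Unique.concat⁺ (All.map⁺ (All.tabulate f!)) (AllPairs.map⁺ (AllPairs.map disjoint tags))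
    where
    disjoint : ∀ {x y} → tag x ≢ tag y → Disjoint (f x) (f y)
    disjoint {x} {y} tx≢ty (z∈fx , z∈fy) = tx≢ty (trans (sym (labelled x z∈fx)) (labelled y z∈fy))

  length-concatMap : ∀ (f : A → List B) xs → length (concatMap f xs) ≡ sum (map (length ∘ f) xs)
  length-concatMap f [] = refl
  length-concatMap f (x ∷ xs) = trans (length-++ (f x)) (cong (length (f x) +_) (length-concatMap f xs))

  length-concatMap-const : ∀ {f : A → List B} {c} → (∀ x → length (f x) ≡ c) → ∀ xs →
    length (concatMap f xs) ≡ length xs * c
  length-concatMap-const f-len [] = refl
  length-concatMap-const {f} f-len (x ∷ xs) =
    trans (length-++ (f x)) (cong₂ _+_ (f-len x) (length-concatMap-const f-len xs))

minList-greatest : ∀ {v} xs → ¬ xs ≡ [] → (∀ {x} → x ∈ xs → v ≤ x) → v ≤ minList xs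
minList-greatest [] xs≢[] _ = ⊥-elim (xs≢[] refl)
minList-greatest (x ∷ []) _ v≤ = v≤ (here refl)
minList-greatest (x ∷ y ∷ ys) _ v≤ = ⊓-glb (v≤ (here refl)) (minList-greatest (y ∷ ys) (λ ()) (v≤ ∘ there))

minList-≡ : ∀ {v} xs → v ∈ xs → (∀ {x} → x ∈ xs → v ≤ x) → minList xs ≡ v
minList-≡ (x ∷ []) (here refl) _ = refl
minList-≡ (x ∷ y ∷ ys) (here refl) v≤ = m≤n⇒m⊓n≡m (minList-greatest (y ∷ ys) (λ ()) (v≤ ∘ there))
minList-≡ (x ∷ y ∷ ys) (there v∈) v≤ = trans (cong (x ⊓_) (minList-≡ (y ∷ ys) v∈ (v≤ ∘ there))) (m≥n⇒m⊓n≡n (v≤ (here refl)))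

-- The number of points of ℕᴹ with coordinate sum at most R, i.e. (R+M choose M).
ballSize : ℕ → ℕ → ℕ
ballSize zero R = 1
ballSize (suc M) R = sum (map (ballSize M) (downFrom (suc R)))

ballSize-pos : ∀ M R → 1 ≤ ballSize M R
ballSize-pos zero R = ≤-refl
ballSize-pos (suc M) zero = ≤-trans (ballSize-pos M 0) (m≤m+n (ballSize M 0) 0)
ballSize-pos (suc M) (suc R) = ≤-trans (ballSize-pos M (suc R)) (m≤m+n (ballSize M (suc R)) (ballSize (suc M) R))

ballSize-≤-suc : ∀ M R → ballSize M R ≤ ballSize M (suc R)
ballSize-≤-suc zero R = ≤-refl
ballSize-≤-suc (suc M) R = m≤n+m (ballSize (suc M) R) (ballSize M (suc R))

ballSize-mono : ∀ M {R R′} → R ≤ R′ → ballSize M R ≤ ballSize M R′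
ballSize-mono M = go ∘ ≤⇒≤′
  where
  go : ∀ {R R′} → R ≤′ R′ → ballSize M R ≤ ballSize M R′
  go ≤′-refl = ≤-refl
  go (≤′-step R≤′R′) = ≤-trans (go R≤′R′) (ballSize-≤-suc M _)

ballSize-≤-dim : ∀ M R → ballSize M R ≤ ballSize (suc M) R
ballSize-≤-dim M zero = m≤m+n (ballSize M 0) 0
ballSize-≤-dim M (suc R) = m≤m+n (ballSize M (suc R)) (ballSize (suc M) R)

ballSize-shell : ∀ M k j → ballSize (suc M) (j + k) ≤ ballSize (suc M) k + j * ballSize M (j + k)
ballSize-shell M k zero = m≤m+n (ballSize (suc M) k) 0
ballSize-shell M k (suc j) = begin
    b M (suc (j + k)) + b (suc M) (j + k)
  ≤⟨ +-monoʳ-≤ (b M (suc (j + k))) (ballSize-shell M k j) ⟩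
    b M (suc (j + k)) + (b (suc M) k + j * b M (j + k))
  ≤⟨ +-monoʳ-≤ (b M (suc (j + k))) (+-monoʳ-≤ (b (suc M) k) (*-monoʳ-≤ j (ballSize-≤-suc M (j + k)))) ⟩
    b M (suc (j + k)) + (b (suc M) k + j * b M (suc (j + k)))
  ≡⟨ x∙yz≈y∙xz (b M (suc (j + k))) (b (suc M) k) (j * b M (suc (j + k))) ⟩
    b (suc M) k + suc j * b M (suc (j + k))
  ∎
  where
  open ≤-Reasoning
  b : ℕ → ℕ → ℕ
  b = ballSize

ballSize-stack : ∀ M g j → suc j * ballSize M g ≤ ballSize (suc M) (j + g)
ballSize-stack M g zero = subst (_≤ ballSize (suc M) g) (sym (+-identityʳ (ballSize M g))) (ballSize-≤-dim M g)
ballSize-stack M g (suc j) = +-mono-≤ (ballSize-mono M (m≤n+m g (suc j))) (ballSize-stack M g j)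

ballSize-doubling : ∀ M g → ballSize M (suc (g + g)) ≤ 2 ^ M * ballSize M g
ballSize-doubling zero g = ≤-refl
ballSize-doubling (suc M) = go
  where
  open ≤-Reasoning
  b : ℕ → ℕ → ℕ
  b = ballSize
  pair : ∀ d → b M (suc (d + d)) + b M (d + d) ≤ 2 ^ suc M * b M d
  pair d = begin
      b M (suc (d + d)) + b M (d + d)
    ≤⟨ +-monoʳ-≤ (b M (suc (d + d))) (ballSize-≤-suc M (d + d)) ⟩
      b M (suc (d + d)) + b M (suc (d + d))
    ≤⟨ +-mono-≤ (ballSize-doubling M d) (ballSize-doubling M d) ⟩
      2 ^ M * b M d + 2 ^ M * b M d
    ≡⟨ twice (2 ^ M) (b M d) ⟩
      2 ^ suc M * b M d
    ∎
    where
    twice : ∀ x y → x * y + x * y ≡ 2 * x * y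
    twice = solve-∀
  go : ∀ g → b (suc M) (suc (g + g)) ≤ 2 ^ suc M * b (suc M) g
  go zero rewrite +-identityʳ (b M 0) = pair 0
  go (suc g) = begin
      b M (suc (d + d)) + (b M (d + d) + b (suc M) (g + suc g))
    ≡⟨ sym (+-assoc (b M (suc (d + d))) (b M (d + d)) (b (suc M) (g + suc g))) ⟩
      b M (suc (d + d)) + b M (d + d) + b (suc M) (g + suc g)
    ≡⟨ cong (λ r → b M (suc (d + d)) + b M (d + d) + b (suc M) r) (+-suc g g) ⟩
      b M (suc (d + d)) + b M (d + d) + b (suc M) (suc (g + g))
    ≤⟨ +-mono-≤ (pair d) (go g) ⟩
      2 ^ suc M * b M d + 2 ^ suc M * b (suc M) g
    ≡⟨ sym (*-distribˡ-+ (2 ^ suc M) (b M d) (b (suc M) g)) ⟩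
      2 ^ suc M * b (suc M) (suc g)
    ∎
    where
    d : ℕ
    d = suc g

-- With k = T + g, g = T + N and T = c · N · 2^M, doubling gives b M (N + k) ≤ 2^M · b M g
-- while stacking gives b N k ≥ (T+1) · b M g.
ballSize-shift : ∀ M c → ∃ λ k → c * ballSize (suc M) (suc M + k) ≤ suc c * ballSize (suc M) k
ballSize-shift M c = k , (begin
    c * b N (N + k)
  ≤⟨ *-monoʳ-≤ c (ballSize-shell M k N) ⟩
    c * (b N k + N * b M (N + k))
  ≡⟨ *-distribˡ-+ c (b N k) (N * b M (N + k)) ⟩
    c * b N k + c * (N * b M (N + k))
  ≤⟨ +-monoʳ-≤ (c * b N k) shell≤ball ⟩
    c * b N k + b N k
  ≡⟨ +-comm (c * b N k) (b N k) ⟩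
    suc c * b N k
  ∎)
  where
  open ≤-Reasoning
  b : ℕ → ℕ → ℕ
  b = ballSize
  N T g k : ℕ
  N = suc M
  T = c * (N * 2 ^ M)
  g = T + N
  k = T + g
  N+k≤1+2g : N + k ≤ suc (g + g)
  N+k≤1+2g = ≤-trans (≤-reflexive (N+k≡2g T N)) (n≤1+n (g + g))
    where
    N+k≡2g : ∀ T N → N + (T + (T + N)) ≡ (T + N) + (T + N)
    N+k≡2g = solve-∀
  shell≤ball : c * (N * b M (N + k)) ≤ b N k
  shell≤ball = begin
      c * (N * b M (N + k))
    ≤⟨ *-monoʳ-≤ c (*-monoʳ-≤ N (≤-trans (ballSize-mono M N+k≤1+2g) (ballSize-doubling M g))) ⟩
      c * (N * (2 ^ M * b M g))
    ≡⟨ reassoc c N (2 ^ M) (b M g) ⟩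
      T * b M g
    ≤⟨ m≤n+m (T * b M g) (b M g) ⟩
      suc T * b M g
    ≤⟨ ballSize-stack M g T ⟩
      b N k
    ∎
    where
    reassoc : ∀ c N t x → c * (N * (t * x)) ≡ c * (N * t) * x
    reassoc = solve-∀

sum-insertAt : ∀ {n} (xs : Vec ℕ n) i v → Vec.sum (insertAt xs i v) ≡ v + Vec.sum xs
sum-insertAt xs zero v = refl
sum-insertAt (x ∷ xs) (suc i) v = trans (cong (x +_) (sum-insertAt xs i v)) (x∙yz≈y∙xz x v (Vec.sum xs))

weight : ∀ {m n} → Point m n → ℕ
weight = Vec.sum ∘ Vec.map toℕ

weight-insertAt : ∀ {m n} (w : Point m n) i a → weight (insertAt w i a) ≡ toℕ a + weight w
weight-insertAt w i a = trans (cong Vec.sum (map-insertAt toℕ a w i)) (sum-insertAt (Vec.map toℕ w) i (toℕ a))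

weight-removeAt-≤ : ∀ {m n} (x : Point m (suc n)) i → weight (removeAt x i) ≤ weight x
weight-removeAt-≤ x i = subst (weight (removeAt x i) ≤_)
  (trans (sym (weight-insertAt (removeAt x i) i (lookup x i))) (cong weight (insertAt-removeAt x i)))
  (m≤n+m (weight (removeAt x i)) (toℕ (lookup x i)))

Lonely : ∀ {m n} → List (Point m n) → Fin n → Point m n → Set
Lonely Y i y = ∀ {z} → z ∈ Y → del z i ≡ del y i → z ≡ y

del-suc : ∀ {m n} x (u : Point m (suc n)) j → del (x ∷ u) (suc j) ≡ x ∷ del u j
del-suc x (_ ∷ _) j = refl

module _ {m n : ℕ} where

  headSlice : Fin m → List (Point m (suc n)) → List (Point m n)
  headSlice a Y = map tail (filter (λ z → head z ≟ᶠ a) Y)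

  ∈-headSlice⁺ : ∀ {Y z} → z ∈ Y → tail z ∈ headSlice (head z) Y
  ∈-headSlice⁺ z∈Y = ∈-map⁺ tail (∈-filter⁺ (λ z → head z ≟ᶠ _) z∈Y refl)

  ∈-headSlice⁻ : ∀ {a Y t} → t ∈ headSlice a Y → (a ∷ t) ∈ Y
  ∈-headSlice⁻ {a} {Y} t∈ with ∈-map⁻ tail t∈
  ... | (x ∷ t) , z∈ , refl with ∈-filter⁻ (λ z → head z ≟ᶠ a) {xs = Y} z∈
  ...   | z∈Y , refl = z∈Y

  lonely-head : ∀ {c k a t} {Y : List (Point m (suc n))} →
    (∀ {z} → z ∈ Y → toℕ (head z) ≤ toℕ a) → (∀ {z} → z ∈ Y → k ≤ c + weight z) →
    c + weight (a ∷ t) ≤ k → Lonely Y zero (a ∷ t)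
  lonely-head {c} {k} {a} {t} below-a above-k light {x ∷ .t} z∈Y refl =
    cong (_∷ t) (toℕ-injective (≤-antisym (below-a z∈Y) a≤x))
    where
    a≤x : toℕ a ≤ toℕ x
    a≤x = +-cancelʳ-≤ (weight t) (toℕ a) (toℕ x) (+-cancelˡ-≤ c _ _ (≤-trans light (above-k z∈Y)))

lonely-lift : ∀ {m n a t} {j : Fin n} {Y : List (Point m (suc n))} →
  Lonely (headSlice a Y) j t → Lonely Y (suc j) (a ∷ t)
lonely-lift {n = suc n} {a} {t} {j} t-lonely {x ∷ u} z∈Y eq
  with x≡a , del-u≡del-t ← ∷-injective (trans (sym (del-suc x u j)) (trans eq (del-suc a t j)))
  rewrite x≡a = cong (a ∷_) (t-lonely (∈-headSlice⁺ z∈Y) del-u≡del-t)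

-- The offset c accumulates the first coordinates fixed along the induction.
lonely-point : ∀ {m n} c k (Y : List (Point m n)) {y₀} → y₀ ∈ Y →
  (∀ {y} → y ∈ Y → k ≤ c + weight y × c + weight y < k + n) →
  ∃₂ λ i y → y ∈ Y × Lonely Y i y
lonely-point {n = zero} c k Y {[]} y₀∈Y band with k≤c , c<k ← band y₀∈Y =
  ⊥-elim (<-irrefl (sym (+-identityʳ k)) (≤-<-trans k≤c c<k))
lonely-point {n = suc n} c k Y {y₀} y₀∈Y band =
  split (any? (λ t → c + weight (a ∷ t) ≤? k) (headSlice a Y))
  where
  top : Point _ (suc n)
  top = argmax (toℕ ∘ head) y₀ Y
  a : Fin _
  a = head top
  top∈Y : top ∈ Y
  top∈Y = argmax-all (toℕ ∘ head) y₀∈Y (All.tabulate id)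
  below-a : ∀ {z} → z ∈ Y → toℕ (head z) ≤ toℕ a
  below-a = All.lookup (f[xs]≤f[argmax] y₀ Y)
  slice-band : ¬ Any (λ t → c + weight (a ∷ t) ≤ k) (headSlice a Y) →
    ∀ {t} → t ∈ headSlice a Y → suc k ≤ (c + toℕ a) + weight t × (c + toℕ a) + weight t < suc k + n
  slice-band no-light {t} t∈ with _ , upper ← band (∈-headSlice⁻ t∈) rewrite +-assoc c (toℕ a) (weight t) =
    ≰⇒> (no-light ∘ lose t∈) , subst (c + weight (a ∷ t) <_) (+-suc k n) upper
  split : Dec (Any (λ t → c + weight (a ∷ t) ≤ k) (headSlice a Y)) → ∃₂ λ i y → y ∈ Y × Lonely Y i y
  split (yes light-in-slice) with t , t∈ , light ← find light-in-slice =
    zero , a ∷ t , ∈-headSlice⁻ t∈ , lonely-head below-a (proj₁ ∘ band) light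
  split (no no-light) with j , t , t∈ , t-lonely ← lonely-point (c + toℕ a) (suc k) (headSlice a Y)
                                                     (∈-headSlice⁺ top∈Y) (slice-band no-light) =
    suc j , a ∷ t , ∈-headSlice⁻ t∈ , lonely-lift t-lonely

module _ {m n : ℕ} {Y : List (Point m (suc n))} (i : Fin (suc n)) where

  ∈-Proj⁺ : ∀ {z} → z ∈ Y → del z i ∈ Proj i Y
  ∈-Proj⁺ z∈Y = ∈-deduplicate⁺ _≟P_ (∈-map⁺ (λ x → del x i) z∈Y)

  Proj-unique : Unique (Proj i Y)
  Proj-unique = deduplicate-! _≟P_ (map (λ x → del x i) Y)

  ∈-Proj⁻ : ∀ {w} → w ∈ Proj i Y → ∃ λ z → z ∈ Y × w ≡ del z i
  ∈-Proj⁻ w∈ = ∈-map⁻ (λ x → del x i) (∈-deduplicate⁻ _≟P_ (map (λ x → del x i) Y) w∈)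

  private
    reinsert : ∀ {z} → z ∈ Y → ins (del z i) i (lookup z i) ∈ Y
    reinsert z∈Y = subst (_∈ Y) (sym (insertAt-removeAt _ i)) z∈Y

  degree-pos : ∀ {z} → z ∈ Y → 1 ≤ degree i Y (del z i)
  degree-pos z∈Y = 1≤length (∈-filter⁺ (λ a → DecMembership._∈?_ _≟P_ (ins _ i a) Y) (∈-allFin _) (reinsert z∈Y))

  degree-lonely : ∀ {y} → y ∈ Y → Lonely Y i y → degree i Y (del y i) ≡ 1
  degree-lonely {y} y∈Y y-lonely =
    length-filter≡1 (λ a → DecMembership._∈?_ _≟P_ (ins (del y i) i a) Y) (Unique.allFin⁺ m) (∈-allFin _) (reinsert y∈Y)
      λ {a} ins∈Y → trans (sym (insertAt-lookup (del y i) i a))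
                          (cong (λ v → lookup v i) (y-lonely ins∈Y (removeAt-insertAt (del y i) i a)))

  minDeg-lonely : ∀ {y} → y ∈ Y → Lonely Y i y → MinDeg i Y ≡ 1
  minDeg-lonely y∈Y y-lonely = minList-≡ _
    (subst (_∈ map (degree i Y) (Proj i Y)) (degree-lonely y∈Y y-lonely) (∈-map⁺ (degree i Y) (∈-Proj⁺ y∈Y)))
    λ d∈ → case ∈-map⁻ (degree i Y) d∈ of λ where
      (w , w∈ , refl) → case ∈-Proj⁻ w∈ of λ where
        (z , z∈Y , refl) → degree-pos z∈Y

avgDeg-bound : ∀ {q n p P Q F X} → 1 ≤ p → F ≤ P → P ≤ Q → F * n ≤ X →
  q * n * Q ≤ suc (q * n) * F → q * n * P ≤ q * X + p * P
avgDeg-bound {q} {n} {p} {P} {Q} {F} {X} 1≤p F≤P P≤Q Fn≤X growth = begin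
  q * n * P        ≤⟨ *-monoʳ-≤ (q * n) P≤Q ⟩
  q * n * Q        ≤⟨ growth ⟩
  F + q * n * F    ≡⟨ cong (F +_) (trans (*-assoc q n F) (cong (q *_) (*-comm n F))) ⟩
  F + q * (F * n)  ≤⟨ +-mono-≤ (≤-trans F≤P (m≤n*m P p {{>-nonZero 1≤p}})) (*-monoʳ-≤ q Fn≤X) ⟩
  p * P + q * X    ≡⟨ +-comm (p * P) (q * X) ⟩
  q * X + p * P    ∎
  where open ≤-Reasoning

module _ {m : ℕ} .{{_ : NonZero m}} where

  -- Reduction modulo m is exact below m (toℕ-fin), hence Ball-unique needs R < m.
  fin : ℕ → Fin m
  fin a = a mod m

  toℕ-fin : ∀ {a} → a < m → toℕ (fin a) ≡ a
  toℕ-fin a<m = trans (toℕ-fromℕ< _) (m<n⇒m%n≡m a<m)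

  toℕ-fin-≤ : ∀ a → toℕ (fin a) ≤ a
  toℕ-fin-≤ a = subst (_≤ a) (sym (toℕ-fromℕ< _)) (m%n≤m a m)

  Ball : ∀ M → ℕ → List (Point m M)
  Ball zero R = [ [] ]
  Ball (suc M) R = concatMap (λ c → map (fin (R ∸ c) ∷_) (Ball M c)) (downFrom (suc R))

  length-Ball : ∀ M R → length (Ball M R) ≡ ballSize M R
  length-Ball zero R = refl
  length-Ball (suc M) R = trans (length-concatMap (λ c → map (fin (R ∸ c) ∷_) (Ball M c)) (downFrom (suc R)))
    (cong sum (map-cong (λ c → trans (length-map (fin (R ∸ c) ∷_) (Ball M c)) (length-Ball M c)) (downFrom (suc R))))

  ∈-Ball⁻ : ∀ {M R v} → v ∈ Ball M R → weight v ≤ R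
  ∈-Ball⁻ {zero} (here refl) = z≤n
  ∈-Ball⁻ {suc M} {R} v∈ with c , c∈ , v∈′ ← find (∈-concatMap⁻ _ {xs = downFrom (suc R)} v∈)
                         with u , u∈ , refl ← ∈-map⁻ _ v∈′ = begin
      toℕ (fin (R ∸ c)) + weight u ≤⟨ +-mono-≤ (toℕ-fin-≤ (R ∸ c)) (∈-Ball⁻ u∈) ⟩
      R ∸ c + c                    ≡⟨ m∸n+n≡m (s≤s⁻¹ (∈-downFrom⁻ c∈)) ⟩
      R                            ∎
    where open ≤-Reasoning

  ∈-Ball⁺ : ∀ {M R} (v : Point m M) → weight v ≤ R → v ∈ Ball M R
  ∈-Ball⁺ [] _ = here refl
  ∈-Ball⁺ {suc M} {R} (x ∷ u) x+u≤R = ∈-concatMap⁺ _ (lose (∈-downFrom⁺ (s≤s (m∸n≤m R (toℕ x))))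
    (subst (λ a → (x ∷ u) ∈ map (a ∷_) (Ball M (R ∸ toℕ x))) (sym head≡x)
      (∈-map⁺ (x ∷_) (∈-Ball⁺ u (m+n≤o⇒m≤o∸n (weight u) (subst (_≤ R) (+-comm (toℕ x) (weight u)) x+u≤R))))))
    where
    head≡x : fin (R ∸ (R ∸ toℕ x)) ≡ x
    head≡x = toℕ-injective (trans (cong (toℕ ∘ fin) (m∸[m∸n]≡n (m+n≤o⇒m≤o (toℕ x) x+u≤R))) (toℕ-fin (toℕ<n x)))

  Ball-unique : ∀ {M R} → R < m → Unique (Ball M R)
  Ball-unique {zero} _ = All.[] ∷ []
  Ball-unique {suc M} {R} R<m = unique-concatMap⁺ head
    (AllPairs.map⁻ (unique-map⁺ head-injective (Unique.downFrom⁺ (suc R))))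
    (λ c∈ → Unique.map⁺ ∷-injectiveʳ (Ball-unique (≤-<-trans (≤-radius c∈) R<m)))
    λ c z∈ → case ∈-map⁻ _ z∈ of λ where (_ , _ , refl) → refl
    where
    ≤-radius : ∀ {c} → c ∈ downFrom (suc R) → c ≤ R
    ≤-radius = s≤s⁻¹ ∘ ∈-downFrom⁻
    head-injective : ∀ {c c′} → c ∈ downFrom (suc R) → c′ ∈ downFrom (suc R) → fin (R ∸ c) ≡ fin (R ∸ c′) → c ≡ c′
    head-injective {c} {c′} c∈ c′∈ eq = ∸-cancelˡ-≡ (≤-radius c∈) (≤-radius c′∈)
      (trans (sym (toℕ-fin (≤-<-trans (m∸n≤m R c) R<m))) (trans (cong toℕ eq) (toℕ-fin (≤-<-trans (m∸n≤m R c′) R<m))))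

module Band (N k : ℕ) where

  X : List (Point (suc (N + k)) (suc N))
  X = filter (λ x → k ≤? weight x) (Ball (suc N) (N + k))

  ∈-X⁻ : ∀ {x} → x ∈ X → k ≤ weight x × weight x ≤ N + k
  ∈-X⁻ x∈X with x∈Ball , k≤x ← ∈-filter⁻ (λ x → k ≤? weight x) {xs = Ball (suc N) (N + k)} x∈X =
    k≤x , ∈-Ball⁻ x∈Ball

  ∈-X⁺ : ∀ {x} → k ≤ weight x → weight x ≤ N + k → x ∈ X
  ∈-X⁺ {x} k≤x x≤N+k = ∈-filter⁺ (λ x → k ≤? weight x) (∈-Ball⁺ x x≤N+k) k≤x

  X-unique : Unique X
  X-unique = Unique.filter⁺ (λ x → k ≤? weight x) (Ball-unique ≤-refl)

  ∈-X⇒band : ∀ {z} → z ∈ X → k ≤ weight z × weight z < k + suc N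
  ∈-X⇒band {z} z∈X with k≤z , z≤N+k ← ∈-X⁻ z∈X =
    k≤z , subst (weight z <_) (trans (cong suc (+-comm N k)) (sym (+-suc k N))) (s≤s z≤N+k)

  X-reducible : Reducible X
  X-reducible [] _ []≢[] = ⊥-elim ([]≢[] refl)
  X-reducible Y@(_ ∷ _) Y⊆X _ with i , z , z∈Y , z-lonely ← lonely-point 0 k Y (here refl) (∈-X⇒band ∘ Y⊆X) =
    i , minDeg-lonely i z∈Y z-lonely

  lift : Fin (suc N) → Point (suc (N + k)) N → ℕ → Point (suc (N + k)) (suc N)
  lift i w t = insertAt w i (fin (k ∸ weight w + t))

  toℕ-lift : ∀ {w : Point (suc (N + k)) N} {t} → t ≤ N → toℕ (fin {suc (N + k)} (k ∸ weight w + t)) ≡ k ∸ weight w + t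
  toℕ-lift {w} {t} t≤N = toℕ-fin (s≤s (subst (k ∸ weight w + t ≤_) (+-comm k N) (+-mono-≤ (m∸n≤m k (weight w)) t≤N)))

  weight-lift : ∀ i {w t} → weight w ≤ k → t ≤ N → weight (lift i w t) ≡ k + t
  weight-lift i {w} {t} w≤k t≤N = begin
      weight (lift i w t)                              ≡⟨ weight-insertAt w i _ ⟩
      toℕ (fin {suc (N + k)} (k ∸ weight w + t)) + weight w ≡⟨ cong (_+ weight w) (toℕ-lift {w} t≤N) ⟩
      k ∸ weight w + t + weight w          ≡⟨ xy∙z≈xz∙y (k ∸ weight w) t (weight w) ⟩
      k ∸ weight w + weight w + t          ≡⟨ cong (_+ t) (m∸n+n≡m w≤k) ⟩
      k + t                                ∎
    where open ≡-Reasoning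

  lift-∈-X : ∀ i {w t} → w ∈ Ball N k → t ≤ N → lift i w t ∈ X
  lift-∈-X i {w} {t} w∈ t≤N = ∈-X⁺ {lift i w t}
    (subst (k ≤_) (sym weight≡) (m≤m+n k t))
    (subst (_≤ N + k) (sym weight≡) (subst (k + t ≤_) (+-comm k N) (+-monoʳ-≤ k t≤N)))
    where
    weight≡ : weight (lift i w t) ≡ k + t
    weight≡ = weight-lift i (∈-Ball⁻ w∈) t≤N

  length-Proj-≤ : ∀ i → length (Proj i X) ≤ ballSize N (N + k)
  length-Proj-≤ i = subst (length (Proj i X) ≤_) (length-Ball N (N + k))
    (length-mono-⊆ (Proj-unique i) (Ball-unique ≤-refl) Proj⊆Ball)
    where
    Proj⊆Ball : Proj i X ⊆ Ball N (N + k)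
    Proj⊆Ball w∈ with z , z∈X , refl ← ∈-Proj⁻ i w∈ =
      ∈-Ball⁺ _ (≤-trans (weight-removeAt-≤ z i) (proj₂ (∈-X⁻ z∈X)))

  k<1+N+k : k < suc (N + k)
  k<1+N+k = s≤s (m≤n+m k N)

  ballSize-≤-length-Proj : ∀ i → ballSize N k ≤ length (Proj i X)
  ballSize-≤-length-Proj i = subst (_≤ length (Proj i X)) (length-Ball N k)
    (length-mono-⊆ (Ball-unique k<1+N+k) (Proj-unique i) Ball⊆Proj)
    where
    Ball⊆Proj : Ball N k ⊆ Proj i X
    Ball⊆Proj {w} w∈ = subst (_∈ Proj i X) (removeAt-insertAt w i _) (∈-Proj⁺ i (lift-∈-X i w∈ z≤n))

  columns : List (Point (suc (N + k)) (suc N))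
  columns = concatMap (λ w → map (lift zero w) (downFrom (suc N))) (Ball N k)

  ∈-downFrom-≤ : ∀ {t} → t ∈ downFrom (suc N) → t ≤ N
  ∈-downFrom-≤ = s≤s⁻¹ ∘ ∈-downFrom⁻

  columns⊆X : columns ⊆ X
  columns⊆X z∈ with w , w∈ , z∈′ ← find (∈-concatMap⁻ _ {xs = Ball N k} z∈)
               with t , t∈ , refl ← ∈-map⁻ _ z∈′ = lift-∈-X zero w∈ (∈-downFrom-≤ t∈)

  columns-unique : Unique columns
  columns-unique = unique-concatMap⁺ tail (Ball-unique k<1+N+k)
    (λ {w} _ → unique-map⁺ (lift-injective w) (Unique.downFrom⁺ (suc N)))
    λ w z∈ → case ∈-map⁻ _ z∈ of λ where (_ , _ , refl) → refl
    where
    lift-injective : ∀ w {t t′} → t ∈ downFrom (suc N) → t′ ∈ downFrom (suc N) →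
      lift zero w t ≡ lift zero w t′ → t ≡ t′
    lift-injective w {t} {t′} t∈ t′∈ eq = +-cancelˡ-≡ (k ∸ weight w) t t′
      (trans (sym (toℕ-lift {w} (∈-downFrom-≤ t∈))) (trans (cong (toℕ ∘ head) eq) (toℕ-lift {w} (∈-downFrom-≤ t′∈))))

  ballSize*n≤length-X : ballSize N k * suc N ≤ length X
  ballSize*n≤length-X = subst (_≤ length X) length-columns (length-mono-⊆ columns-unique X-unique columns⊆X)
    where
    length-columns : length columns ≡ ballSize N k * suc N
    length-columns = trans
      (length-concatMap-const (λ w → trans (length-map (lift zero w) (downFrom (suc N))) (length-downFrom (suc N))) (Ball N k))
      (cong (_* suc N) (length-Ball N k))

  X-nonempty : ¬ X ≡ []
  X-nonempty X≡[] = 1+n≰n (≤-trans (*-mono-≤ (ballSize-pos N k) (s≤s z≤n))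
    (subst (λ Y → ballSize N k * suc N ≤ length Y) X≡[] ballSize*n≤length-X))

lemma5 : (p q : ℕ) → 0 < p → 0 < q → (n : ℕ) → 2 ≤ n →
    Σ ℕ λ m → 0 < m × Σ (List (Point m n)) λ X →
      Unique X × ¬ (X ≡ []) × Reducible X ×
      ((i : Fin n) → q * n * length (Proj i X) ≤ q * length X + p * length (Proj i X))
lemma5 p q 0<p _ (suc (suc M)) (s≤s (s≤s z≤n)) with k , growth ← ballSize-shift M (q * suc (suc M)) =
  let open Band (suc M) k in
  suc (suc M + k) , s≤s z≤n , X , X-unique , X-nonempty , X-reducible ,
  λ i → avgDeg-bound {q} 0<p (ballSize-≤-length-Proj i) (length-Proj-≤ i) ballSize*n≤length-X growth
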